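{- Let $\pi=\alpha\,u\,v\,\beta\in\mathfrak S_n$ and $\rho=\alpha\,v\,u\,\beta$, where $\alpha,\beta$ are words and $u<v$. If the pair $(u,v)$ is not Tonks-independent in $\pi$, i.e. no entry of $\beta$ lies strictly between $u$ and $v$, then $\phi(\pi)<_T\phi(\rho)$.
   Context: $\mathfrak S_n$ is the symmetric group on $[n]$ in one-line notation. For $n\ge1$, $Y_n$ is the set of planar binary trees with $n$ internal nodes ($n+1$ leaves ordered left to right); $Y_0=\{\ast\}$, the trivial one-vertex tree; $t\in Y_1$ is the 2-corolla and $T\triangleleft_i t$ is the tree obtained by grafting $t$ onto the $i$-th leaf of $T$; $\mathrm{std}$ denotes standardization of words of distinct integers. Tonks' vertex map $\phi:\mathfrak S_n\to Y_n$ (restriction to vertices of Tonks' projection from the permutohedron to the associahedron): $\phi(\emptyset)=\ast$, $\phi(1)=t$, $\phi(\pi)=\phi(\mathrm{std}(\pi_2\cdots\pi_n))\triangleleft_{\pi_1}t$ for $n>1$. The Tamari order $\le_T$ on $Y_n$ is the reflexive–transitive closure of the right rotation $((X,Y),Z)\to(X,(Y,Z))$ at any subtree, where $(A,B)$ denotes the tree with a root whose left subtree is $A$ and right subtree is $B$; $<_T$ is the corresponding strict order. -}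

module Defs where

open import Data.Nat using (ℕ; zero; suc; _+_; _∸_; _<_; _<ᵇ_; _≤ᵇ_)
open import Data.Bool using (Bool; true; false; if_then_else_)
open import Data.List using (List; []; _∷_; length; map; filter; applyUpTo)
open import Data.List.Relation.Binary.Permutation.Propositional using (_↭_)
open import Data.Product using (_×_)
open import Relation.Binary.PropositionalEquality using (_≡_; _≢_)
open import Relation.Binary.Construct.Closure.ReflexiveTransitive using (Star)

IsPerm : ℕ → List ℕ → Set
IsPerm n w = w ↭ applyUpTo suc n

countLess : ℕ → List ℕ → ℕ
countLess x []       = 0
countLess x (y ∷ ys) = (if y <ᵇ x then 1 else 0) + countLess x ys

std : List ℕ → List ℕ
std w = map (λ x → suc (countLess x w)) w

data Tree : Set where
  leaf : Tree
  node : Tree → Tree → Tree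

leaves : Tree → ℕ
leaves leaf       = 1
leaves (node l r) = leaves l + leaves r

corolla : Tree
corolla = node leaf leaf

-- T ◁ i : graft the corolla onto the i-th leaf (1-based, left to right) of T
graft : Tree → ℕ → Tree
graft leaf       i = if i ≡ᵇ' 1 then corolla else leaf
  where
    _≡ᵇ'_ : ℕ → ℕ → Bool
    zero ≡ᵇ' zero = true
    zero ≡ᵇ' suc _ = false
    suc _ ≡ᵇ' zero = false
    suc a ≡ᵇ' suc b = a ≡ᵇ' b
graft (node l r) i = if i ≤ᵇ leaves l
                       then node (graft l i) r
                       else node l (graft r (i ∸ leaves l))

-- Tonks' vertex map, with fuel equal to the length of the word
-- (std preserves length, so this is the recursion φ(π) = φ(std(π₂⋯πₙ)) ◁_{π₁} t)
phiAux : ℕ → List ℕ → Tree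
phiAux zero    _        = leaf
phiAux (suc k) []       = leaf
phiAux (suc k) (x ∷ xs) = graft (phiAux k (std xs)) x

phi : List ℕ → Tree
phi w = phiAux (length w) w

data Rot : Tree → Tree → Set where
  rot-here : ∀ {X Y Z} → Rot (node (node X Y) Z) (node X (node Y Z))
  rot-left : ∀ {A A' B} → Rot A A' → Rot (node A B) (node A' B)
  rot-right : ∀ {A B B'} → Rot B B' → Rot (node A B) (node A B')

_≤T_ : Tree → Tree → Set
_≤T_ = Star Rot

_<T_ : Tree → Tree → Set
S <T T = S ≤T T × S ≢ T

{-# OPTIONS --safe #-}
-- For a permutation π we have std π = π, so it suffices to compare φ(std(α u v β))
-- with φ(std(α v u β)).  For every word, φ(std(a w)) = φ(std w) ◁ r where r is the
-- rank of a in a w, and r does not change when u and v are swapped; since grafting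
-- at a fixed leaf preserves right rotations, induction on α reduces to α empty.
-- There, if no entry of β lies in [u, v) and T = φ(std β), i = rank of u in β, then
-- φ(std(u v β)) = (T ◁ i) ◁ i and φ(std(v u β)) = (T ◁ i) ◁ (i + 1): the corolla
-- grafted at leaf i of T receives a second corolla on its left, resp. right, leaf.
-- Locally these are ((·,·),·) and (·,(·,·)), so the trees differ by one right
-- rotation, and a rotation never maps a tree to itself.
module Submission where

open import Defs
open import Data.Nat using (ℕ; _<_)
open import Data.List using (List; _∷_; _++_)
open import Data.List.Relation.Unary.All using (All)
open import Data.Product using (_×_)
open import Relation.Nullary using (¬_)

open import Data.Bool using (true; false; if_then_else_)
open import Data.Nat using (zero; suc; _+_; _∸_; _≤_; _≮_; _<ᵇ_; _≤ᵇ_; z≤n; s≤s; s<s; s<s⁻¹; _<?_)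
open import Data.Nat.Properties
open import Algebra.Properties.CommutativeSemigroup +-commutativeSemigroup using (x∙yz≈y∙xz)
open import Data.List using ([]; map; length; applyUpTo)
open import Data.List.Properties using (map-∘; map-cong-local; map-id-local; length-map; map-applyUpTo)
import Data.List.Relation.Unary.All as All
open import Data.List.Relation.Unary.All using ([]; _∷_)
open import Data.List.Relation.Unary.Any using (here; there)
open import Data.List.Membership.Propositional using (_∈_)
open import Data.List.Membership.Propositional.Properties using (∈-applyUpTo⁻)
open import Data.List.Relation.Unary.Unique.Propositional using (Unique)
import Data.List.Relation.Unary.AllPairs as AllPairs
open import Data.List.Relation.Unary.Unique.Propositional.Properties using (applyUpTo⁺₁)
open import Data.List.Relation.Binary.Permutation.Propositional using (_↭_; ↭-sym; prep; swap; ↭⇒↭ₛ)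
  renaming (refl to ↭-refl; trans to ↭-trans)
open import Data.List.Relation.Binary.Permutation.Propositional.Properties using (∈-resp-↭; ++⁺ˡ)
open import Data.List.Relation.Binary.Permutation.Setoid.Properties using (Unique-resp-↭)
open import Data.Product using (_,_)
open import Data.Sum using (inj₁; inj₂)
open import Function using (_∘_; _⇔_; Equivalence; mk⇔)
open import Relation.Binary.Construct.Closure.ReflexiveTransitive using (ε; _◅_)
open import Relation.Binary.PropositionalEquality using (_≡_; _≢_; refl; sym; trans; cong; cong₂; subst; subst₂; setoid; module ≡-Reasoning)
open import Relation.Binary.Definitions using (tri<; tri≈; tri>)
open import Relation.Nullary using (yes; no; contradiction)
open import Relation.Nullary.Reflects using (ofʸ; ofⁿ; det; fromEquivalence)

<ᵇ-true : ∀ {m n} → m < n → (m <ᵇ n) ≡ true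
<ᵇ-true m<n = det (<ᵇ-reflects-< _ _) (ofʸ m<n)

<ᵇ-false : ∀ {m n} → m ≮ n → (m <ᵇ n) ≡ false
<ᵇ-false m≮n = det (<ᵇ-reflects-< _ _) (ofⁿ m≮n)

<ᵇ-cong : ∀ {m n o p} → (m < n ⇔ o < p) → (m <ᵇ n) ≡ (o <ᵇ p)
<ᵇ-cong {m} {n} {o} {p} m<n⇔o<p = det (<ᵇ-reflects-< m n)
  (fromEquivalence (Equivalence.from m<n⇔o<p ∘ <ᵇ⇒< o p) (<⇒<ᵇ ∘ Equivalence.to m<n⇔o<p))

≤ᵇ-true : ∀ {m n} → m ≤ n → (m ≤ᵇ n) ≡ true
≤ᵇ-true m≤n = det (≤ᵇ-reflects-≤ _ _) (ofʸ m≤n)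

≤ᵇ-false : ∀ {m n} → n < m → (m ≤ᵇ n) ≡ false
≤ᵇ-false n<m = det (≤ᵇ-reflects-≤ _ _) (ofⁿ (<⇒≱ n<m))

lessIndicator : ℕ → ℕ → ℕ
lessIndicator y x = if y <ᵇ x then 1 else 0

countLess-∷-< : ∀ {x y} ys → y < x → countLess x (y ∷ ys) ≡ suc (countLess x ys)
countLess-∷-< ys y<x rewrite <ᵇ-true y<x = refl

countLess-∷-≮ : ∀ {x y} ys → y ≮ x → countLess x (y ∷ ys) ≡ countLess x ys
countLess-∷-≮ ys y≮x rewrite <ᵇ-false y≮x = refl

countLess-self-∷ : ∀ x ys → countLess x (x ∷ ys) ≡ countLess x ys
countLess-self-∷ x ys = countLess-∷-≮ ys (<-irrefl refl)

countLess-≤-length : ∀ x w → countLess x w ≤ length w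
countLess-≤-length x []       = z≤n
countLess-≤-length x (y ∷ ys) with y <ᵇ x
... | true  = s≤s (countLess-≤-length x ys)
... | false = m≤n⇒m≤1+n (countLess-≤-length x ys)

lessIndicator-mono : ∀ {x y} z → x ≤ y → lessIndicator z x ≤ lessIndicator z y
lessIndicator-mono {x} z x≤y with z <? x
... | yes z<x rewrite <ᵇ-true z<x | <ᵇ-true (<-≤-trans z<x x≤y) = ≤-refl
... | no z≮x  rewrite <ᵇ-false z≮x = z≤n

countLess-mono-≤ : ∀ {x y} → x ≤ y → ∀ w → countLess x w ≤ countLess y w
countLess-mono-≤ x≤y []       = z≤n
countLess-mono-≤ x≤y (z ∷ zs) = +-mono-≤ (lessIndicator-mono z x≤y) (countLess-mono-≤ x≤y zs)

countLess-strictMono : ∀ {x y w} → x < y → x ∈ w → countLess x w < countLess y w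
countLess-strictMono {x} {y} x<y (here {xs = zs} refl) = begin-strict
  countLess x (x ∷ zs)  ≡⟨ countLess-self-∷ x zs ⟩
  countLess x zs        ≤⟨ countLess-mono-≤ (<⇒≤ x<y) zs ⟩
  countLess y zs        <⟨ n<1+n _ ⟩
  suc (countLess y zs)  ≡⟨ countLess-∷-< zs x<y ⟨
  countLess y (x ∷ zs)  ∎
  where open ≤-Reasoning
countLess-strictMono x<y (there {x = z} x∈zs) =
  +-mono-≤-< (lessIndicator-mono z (<⇒≤ x<y)) (countLess-strictMono x<y x∈zs)

countLess-cong : ∀ {x y} w → All (λ z → z < x ⇔ z < y) w → countLess x w ≡ countLess y w
countLess-cong []       []            = refl
countLess-cong (z ∷ zs) (z<x⇔z<y ∷ p) =
  cong₂ _+_ (cong (λ b → if b then 1 else 0) (<ᵇ-cong z<x⇔z<y)) (countLess-cong zs p)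

countLess-gap : ∀ {u v} → u ≤ v → ∀ β → All (λ x → ¬ (u ≤ x × x < v)) β →
                countLess u β ≡ countLess v β
countLess-gap u≤v β gap = countLess-cong β (All.map (λ x∉[u,v[ →
  mk⇔ (λ x<u → <-≤-trans x<u u≤v) (λ x<v → ≰⇒> λ u≤x → x∉[u,v[ (u≤x , x<v))) gap)

countLess-map : ∀ (f : ℕ → ℕ) {x} w → All (λ z → f z < f x ⇔ z < x) w →
                countLess (f x) (map f w) ≡ countLess x w
countLess-map f []       []              = refl
countLess-map f (z ∷ zs) (fz<fx⇔z<x ∷ p) =
  cong₂ _+_ (cong (λ b → if b then 1 else 0) (<ᵇ-cong fz<fx⇔z<x)) (countLess-map f zs p)

countLess-resp-↭ : ∀ x {xs ys} → xs ↭ ys → countLess x xs ≡ countLess x ys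
countLess-resp-↭ x ↭-refl        = refl
countLess-resp-↭ x (prep y p)    = cong (lessIndicator y x +_) (countLess-resp-↭ x p)
countLess-resp-↭ x (swap y z p)  =
  trans (x∙yz≈y∙xz (lessIndicator y x) (lessIndicator z x) _)
        (cong (λ c → lessIndicator z x + (lessIndicator y x + c)) (countLess-resp-↭ x p))
countLess-resp-↭ x (↭-trans p q) = trans (countLess-resp-↭ x p) (countLess-resp-↭ x q)

countLess-zero : ∀ w → countLess 0 w ≡ 0
countLess-zero []       = refl
countLess-zero (_ ∷ ys) = countLess-zero ys

countLess-map-suc : ∀ x w → countLess (suc x) (map suc w) ≡ countLess x w
countLess-map-suc x w = countLess-map suc w (All.universal (λ _ → mk⇔ s<s⁻¹ s<s) w)

countLess-applyUpTo-suc : ∀ {x} n → x ≤ n → countLess (suc x) (applyUpTo suc n) ≡ x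
countLess-applyUpTo-suc     zero    z≤n   = refl
countLess-applyUpTo-suc {x} (suc n) x≤1+n = begin
  countLess (suc x) (1 ∷ applyUpTo (suc ∘ suc) n)
    ≡⟨ cong (countLess (suc x) ∘ (1 ∷_)) (map-applyUpTo suc suc n) ⟨
  countLess (suc x) (1 ∷ map suc (applyUpTo suc n))
    ≡⟨ cong (lessIndicator 1 (suc x) +_) (countLess-map-suc x (applyUpTo suc n)) ⟩
  lessIndicator 0 x + countLess x (applyUpTo suc n)
    ≡⟨ first-and-rest x x≤1+n ⟩
  x ∎
  where
    open ≡-Reasoning
    first-and-rest : ∀ x → x ≤ suc n → lessIndicator 0 x + countLess x (applyUpTo suc n) ≡ x
    first-and-rest zero    _         = countLess-zero (applyUpTo suc n)
    first-and-rest (suc y) (s≤s y≤n) = cong suc (countLess-applyUpTo-suc n y≤n)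

rank : List ℕ → ℕ → ℕ
rank w x = suc (countLess x w)

StrictlyMonotoneOn : List ℕ → (ℕ → ℕ) → Set
StrictlyMonotoneOn xs f = ∀ {x y} → x ∈ xs → y ∈ xs → x < y → f x < f y

strictlyMonotoneOn-cancel-< : ∀ {xs f x y} → StrictlyMonotoneOn xs f →
                              x ∈ xs → y ∈ xs → f x < f y → x < y
strictlyMonotoneOn-cancel-< {x = x} {y} mono x∈xs y∈xs fx<fy with <-cmp x y
... | tri< x<y _    _   = x<y
... | tri≈ _   refl _   = contradiction fx<fy (<-irrefl refl)
... | tri> _   _    y<x = contradiction fx<fy (<-asym (mono y∈xs x∈xs y<x))

std-map : ∀ {f} xs → StrictlyMonotoneOn xs f → std (map f xs) ≡ std xs
std-map {f} xs mono = begin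
  map (rank (map f xs)) (map f xs)  ≡⟨ map-∘ xs ⟨
  map (rank (map f xs) ∘ f) xs      ≡⟨ map-cong-local (All.tabulate (cong suc ∘ rank-preserved)) ⟩
  map (rank xs) xs                  ∎
  where
    open ≡-Reasoning
    rank-preserved : ∀ {y} → y ∈ xs → countLess (f y) (map f xs) ≡ countLess y xs
    rank-preserved y∈xs = countLess-map f xs (All.tabulate λ z∈xs →
      mk⇔ (strictlyMonotoneOn-cancel-< mono z∈xs y∈xs) (mono z∈xs y∈xs))

rank-strictlyMonotoneOn : ∀ w → StrictlyMonotoneOn w (rank w)
rank-strictlyMonotoneOn w x∈w _ x<y = s<s (countLess-strictMono x<y x∈w)

phi-std-∷ : ∀ x xs → phi (std (x ∷ xs)) ≡ graft (phi (std xs)) (rank (x ∷ xs) x)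
phi-std-∷ x xs = cong (λ T → graft T (rank (x ∷ xs) x)) (cong₂ phiAux same-length same-std)
  where
    same-length : length (map (rank (x ∷ xs)) xs) ≡ length (std xs)
    same-length = trans (length-map (rank (x ∷ xs)) xs) (sym (length-map (rank xs) xs))
    same-std : std (map (rank (x ∷ xs)) xs) ≡ std xs
    same-std = std-map xs λ y∈xs z∈xs → rank-strictlyMonotoneOn (x ∷ xs) (there y∈xs) (there z∈xs)

std-perm : ∀ {n w} → IsPerm n w → std w ≡ w
std-perm {n} {w} w↭ = map-id-local (All.tabulate rank-fixed)
  where
    rank-fixed : ∀ {x} → x ∈ w → rank w x ≡ x
    rank-fixed x∈w with ∈-applyUpTo⁻ suc (∈-resp-↭ w↭ x∈w)
    ... | i , i<n , refl =
      cong suc (trans (countLess-resp-↭ (suc i) w↭) (countLess-applyUpTo-suc n (<⇒≤ i<n)))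

perm-unique : ∀ {n w} → IsPerm n w → Unique w
perm-unique {n} w↭ = Unique-resp-↭ (setoid ℕ) (↭⇒↭ₛ (↭-sym w↭))
  (applyUpTo⁺₁ suc n λ i<j _ → <⇒≢ i<j ∘ suc-injective)

Unique-++⁻ʳ : ∀ {a} {A : Set a} (α : List A) {xs} → Unique (α ++ xs) → Unique xs
Unique-++⁻ʳ []      uniq = uniq
Unique-++⁻ʳ (_ ∷ α) uniq = Unique-++⁻ʳ α (AllPairs.tail uniq)

graft-node-≤ : ∀ l r {i} → i ≤ leaves l → graft (node l r) i ≡ node (graft l i) r
graft-node-≤ l r i≤l rewrite ≤ᵇ-true i≤l = refl

graft-node-> : ∀ l r {i} → leaves l < i → graft (node l r) i ≡ node l (graft r (i ∸ leaves l))
graft-node-> l r l<i rewrite ≤ᵇ-false l<i = refl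

∸-leaf-index : ∀ {i m n} → m < i → i ≤ m + n → 1 ≤ i ∸ m × i ∸ m ≤ n
∸-leaf-index {i} {m} m<i i≤m+n = m<n⇒0<n∸m m<i , m≤n+o⇒m∸n≤o i m i≤m+n

m+n<o⇒n<o∸m : ∀ m {n o} → m + n < o → n < o ∸ m
m+n<o⇒n<o∸m m {n} {o} m+n<o = subst (_< o ∸ m) (m+n∸m≡n m n) (∸-monoˡ-< m+n<o (m≤m+n m n))

leaves-graft : ∀ T {i} → 1 ≤ i → i ≤ leaves T → leaves (graft T i) ≡ suc (leaves T)
leaves-graft leaf       (s≤s z≤n) (s≤s z≤n) = refl
leaves-graft (node l r) {i} 1≤i i≤lr with ≤-<-connex i (leaves l)
... | inj₁ i≤l rewrite graft-node-≤ l r i≤l = cong (_+ leaves r) (leaves-graft l 1≤i i≤l)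
... | inj₂ l<i rewrite graft-node-> l r l<i =
  let 1≤k , k≤r = ∸-leaf-index l<i i≤lr
  in trans (cong (leaves l +_) (leaves-graft r 1≤k k≤r)) (+-suc (leaves l) (leaves r))

<-leaves-graft : ∀ T {i} → 1 ≤ i → i ≤ leaves T → i < leaves (graft T i)
<-leaves-graft T {i} 1≤i i≤T = subst (i <_) (sym (leaves-graft T 1≤i i≤T)) (s≤s i≤T)

graft-graft-Rot : ∀ T {i} → 1 ≤ i → i ≤ leaves T →
                  Rot (graft (graft T i) i) (graft (graft T i) (suc i))
graft-graft-Rot leaf       (s≤s z≤n) (s≤s z≤n) = rot-here
graft-graft-Rot (node l r) {i} 1≤i i≤lr with ≤-<-connex i (leaves l)
... | inj₁ i≤l
  rewrite graft-node-≤ l r i≤l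
        | graft-node-≤ (graft l i) r (<⇒≤ (<-leaves-graft l 1≤i i≤l))
        | graft-node-≤ (graft l i) r (<-leaves-graft l 1≤i i≤l)
  = rot-left (graft-graft-Rot l 1≤i i≤l)
... | inj₂ l<i
  rewrite graft-node-> l r l<i
        | graft-node-> l (graft r (i ∸ leaves l)) l<i
        | graft-node-> l (graft r (i ∸ leaves l)) (m<n⇒m<1+n l<i)
        | +-∸-assoc 1 (<⇒≤ l<i)
  = let 1≤k , k≤r = ∸-leaf-index l<i i≤lr in rot-right (graft-graft-Rot r 1≤k k≤r)

Rot-leaves : ∀ {A B} → Rot A B → leaves A ≡ leaves B
Rot-leaves (rot-here {X} {Y} {Z})  = +-assoc (leaves X) (leaves Y) (leaves Z)
Rot-leaves (rot-left {B = B} r)    = cong (_+ leaves B) (Rot-leaves r)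
Rot-leaves (rot-right {A = A} r)   = cong (leaves A +_) (Rot-leaves r)

graft-preserves-Rot : ∀ {A B} i → Rot A B → Rot (graft A i) (graft B i)
graft-preserves-Rot i (rot-here {X} {Y} {Z}) with ≤-<-connex i (leaves X)
... | inj₁ i≤X
  rewrite graft-node-≤ (node X Y) Z (≤-trans i≤X (m≤m+n (leaves X) (leaves Y)))
        | graft-node-≤ X Y i≤X
        | graft-node-≤ X (node Y Z) i≤X
  = rot-here
... | inj₂ X<i with ≤-<-connex i (leaves X + leaves Y)
...   | inj₁ i≤XY
  rewrite graft-node-≤ (node X Y) Z i≤XY
        | graft-node-> X Y X<i
        | graft-node-> X (node Y Z) X<i
        | graft-node-≤ Y Z (m≤n+o⇒m∸n≤o i (leaves X) i≤XY)
  = rot-here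
...   | inj₂ XY<i
  rewrite graft-node-> (node X Y) Z XY<i
        | graft-node-> X (node Y Z) X<i
        | graft-node-> Y Z (m+n<o⇒n<o∸m (leaves X) XY<i)
        | ∸-+-assoc i (leaves X) (leaves Y)
  = rot-here
graft-preserves-Rot i (rot-left {A} {A′} {B} r) with ≤-<-connex i (leaves A)
... | inj₁ i≤A
  rewrite graft-node-≤ A B i≤A | graft-node-≤ A′ B (subst (i ≤_) (Rot-leaves r) i≤A)
  = rot-left (graft-preserves-Rot i r)
... | inj₂ A<i
  rewrite graft-node-> A B A<i | graft-node-> A′ B (subst (_< i) (Rot-leaves r) A<i) | Rot-leaves r
  = rot-left r
graft-preserves-Rot i (rot-right {A} {B} {B′} r) with ≤-<-connex i (leaves A)
... | inj₁ i≤A rewrite graft-node-≤ A B i≤A | graft-node-≤ A B′ i≤A = rot-right r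
... | inj₂ A<i rewrite graft-node-> A B A<i | graft-node-> A B′ A<i
  = rot-right (graft-preserves-Rot (i ∸ leaves A) r)

Rot⇒≢ : ∀ {A B} → Rot A B → A ≢ B
Rot⇒≢ rot-here      ()
Rot⇒≢ (rot-left r)  refl = Rot⇒≢ r refl
Rot⇒≢ (rot-right r) refl = Rot⇒≢ r refl

Rot⇒<T : ∀ {A B} → Rot A B → A <T B
Rot⇒<T r = r ◅ ε , Rot⇒≢ r

leaves-phi-std : ∀ w → leaves (phi (std w)) ≡ suc (length w)
leaves-phi-std []       = refl
leaves-phi-std (x ∷ xs) = begin
  leaves (phi (std (x ∷ xs)))                      ≡⟨ cong leaves (phi-std-∷ x xs) ⟩
  leaves (graft (phi (std xs)) (rank (x ∷ xs) x))  ≡⟨ leaves-graft (phi (std xs)) (s≤s z≤n) rank≤leaves ⟩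
  suc (leaves (phi (std xs)))                      ≡⟨ cong suc (leaves-phi-std xs) ⟩
  suc (suc (length xs))                            ∎
  where
    open ≡-Reasoning
    rank≤leaves : rank (x ∷ xs) x ≤ leaves (phi (std xs))
    rank≤leaves = subst₂ _≤_ (cong suc (sym (countLess-self-∷ x xs))) (sym (leaves-phi-std xs))
                             (s≤s (countLess-≤-length x xs))

phi-std-swap-head : ∀ {u v} β → u < v → All (λ x → ¬ (u ≤ x × x < v)) β →
                    Rot (phi (std (u ∷ v ∷ β))) (phi (std (v ∷ u ∷ β)))
phi-std-swap-head {u} {v} β u<v gap =
  subst₂ Rot (sym (phi-std-∷∷ rank-vβ rank-uvβ)) (sym (phi-std-∷∷ rank-uβ rank-vuβ))
    (graft-graft-Rot T (s≤s z≤n) i≤leaves)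
  where
    T = phi (std β)
    i = rank β u

    phi-std-∷∷ : ∀ {x y j k} → rank (y ∷ β) y ≡ j → rank (x ∷ y ∷ β) x ≡ k →
                 phi (std (x ∷ y ∷ β)) ≡ graft (graft T j) k
    phi-std-∷∷ {x} {y} refl refl =
      trans (phi-std-∷ x (y ∷ β)) (cong (λ S → graft S (rank (x ∷ y ∷ β) x)) (phi-std-∷ y β))

    same-count : countLess v β ≡ countLess u β
    same-count = sym (countLess-gap (<⇒≤ u<v) β gap)

    rank-vβ : rank (v ∷ β) v ≡ i
    rank-vβ = cong suc (trans (countLess-self-∷ v β) same-count)
    rank-uvβ : rank (u ∷ v ∷ β) u ≡ i
    rank-uvβ = cong suc (trans (countLess-self-∷ u (v ∷ β)) (countLess-∷-≮ β (<⇒≯ u<v)))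
    rank-uβ : rank (u ∷ β) u ≡ i
    rank-uβ = cong suc (countLess-self-∷ u β)
    rank-vuβ : rank (v ∷ u ∷ β) v ≡ suc i
    rank-vuβ = cong suc (trans (countLess-self-∷ v (u ∷ β))
                               (trans (countLess-∷-< β u<v) (cong suc same-count)))

    i≤leaves : i ≤ leaves T
    i≤leaves = subst (i ≤_) (sym (leaves-phi-std β)) (s≤s (countLess-≤-length u β))

phi-std-swap : ∀ α {u v} β → u < v → All (λ x → ¬ (u ≤ x × x < v)) β →
               Rot (phi (std (α ++ u ∷ v ∷ β))) (phi (std (α ++ v ∷ u ∷ β)))
phi-std-swap []              β u<v gap = phi-std-swap-head β u<v gap
phi-std-swap (a ∷ α) {u} {v} β u<v gap =
  subst₂ Rot (sym (phi-std-∷ a π)) (sym aρ)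
    (graft-preserves-Rot (rank (a ∷ π) a) (phi-std-swap α β u<v gap))
  where
    π = α ++ u ∷ v ∷ β
    ρ = α ++ v ∷ u ∷ β
    same-rank : rank (a ∷ ρ) a ≡ rank (a ∷ π) a
    same-rank = cong suc (countLess-resp-↭ a (prep a (++⁺ˡ α (swap v u ↭-refl))))
    aρ : phi (std (a ∷ ρ)) ≡ graft (phi (std ρ)) (rank (a ∷ π) a)
    aρ = trans (phi-std-∷ a ρ) (cong (graft (phi (std ρ))) same-rank)

lemma5p3 : (n u v : ℕ) (α β : List ℕ) →
    IsPerm n (α ++ u ∷ v ∷ β) →
    u < v →
    All (λ x → ¬ (u < x × x < v)) β →
    phi (α ++ u ∷ v ∷ β) <T phi (α ++ v ∷ u ∷ β)
lemma5p3 n u v α β π-perm u<v nothing-between = Rot⇒<T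
  (subst₂ Rot (cong phi (std-perm π-perm)) (cong phi (std-perm ρ-perm)) (phi-std-swap α β u<v gap))
  where
    ρ-perm : IsPerm n (α ++ v ∷ u ∷ β)
    ρ-perm = ↭-trans (++⁺ˡ α (swap v u ↭-refl)) π-perm
    u∉β : All (u ≢_) β
    u∉β = All.tail (AllPairs.head (Unique-++⁻ʳ α (perm-unique π-perm)))
    gap : All (λ x → ¬ (u ≤ x × x < v)) β
    gap = All.zipWith (λ (u≢x , x∉⟨u,v⟩) (u≤x , x<v) → x∉⟨u,v⟩ (≤∧≢⇒< u≤x u≢x , x<v))
                      (u∉β , nothing-between)
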